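{- Let $C$ be a non-trivial strongly connected component in $\mathrm{BPA}^*_{01}$. If $p_1$ and $p_2$ are alive exit states in $C$, then $\mathrm{Ext}_n(p_1)=\mathrm{Ext}_n(p_2)$.
   Context: Fix a non-empty set $A$ of actions. $\mathrm{BPA}^*_{01}$ expressions are generated by $p ::= \mathbf{0} \mid \mathbf{1} \mid a \mid p\cdot p \mid p+p \mid p^*$ with $a\in A$ (equality is syntactic identity). The transition relation $p\xrightarrow{a}p'$ and termination predicate $p\downarrow$ are the least relations such that: $\mathbf{1}\downarrow$; $a\xrightarrow{a}\mathbf{1}$; if $p\xrightarrow{a}p'$ then $p+q\xrightarrow{a}p'$ and $q+p\xrightarrow{a}p'$; if $p\downarrow$ then $(p+q)\downarrow$ and $(q+p)\downarrow$; if $p\xrightarrow{a}p'$ then $p\cdot q\xrightarrow{a}p'\cdot q$; if $p\downarrow$ and $q\xrightarrow{a}q'$ then $p\cdot q\xrightarrow{a}q'$; if $p\downarrow$ and $q\downarrow$ then $(p\cdot q)\downarrow$; if $p\xrightarrow{a}p'$ then $p^*\xrightarrow{a}p'\cdot p^*$; $p^*\downarrow$. Write $p\to q$ if $p\xrightarrow{a}q$ for some $a$, and $\to^*$ for its reflexive-transitive closure. A strongly connected component is a maximal set $C$ of expressions with $s\to^* s'$ for all $s,s'\in C$; it is trivial if $C=\{s\}$ and not $s\to s$, non-trivial otherwise. An expression $s$ is normed if $s\to^* s'$ for some $s'$ with $s'\downarrow$. For $s$ in a strongly connected component $C$, the normed exit transitions of $s$ are $\mathrm{Ext}_n(s)=\{(a,s')\mid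 s\xrightarrow{a}s',\ s'\notin C,\ s'\text{ normed}\}$. A state $s\in C$ is an alive exit state if $s\downarrow$ or $\mathrm{Ext}_n(s)\neq\emptyset$. -}

module Defs where

open import Level using (Level; _⊔_; suc)
open import Data.Product using (Σ; _×_; _,_)
open import Data.Sum using (_⊎_)
open import Relation.Nullary using (¬_)
open import Relation.Binary.PropositionalEquality using (_≡_)
open import Relation.Binary.Construct.Closure.ReflexiveTransitive using (Star)

data Exp {ℓ : Level} (A : Set ℓ) : Set ℓ where
  𝟘   : Exp A
  𝟙   : Exp A
  act : A → Exp A
  _·_ : Exp A → Exp A → Exp A
  _⊕_ : Exp A → Exp A → Exp A
  _⋆  : Exp A → Exp A

module _ {ℓ : Level} {A : Set ℓ} where

  data _↓ : Exp A → Set ℓ where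
    𝟙↓  : 𝟙 ↓
    +↓ˡ : ∀ {p q} → p ↓ → (p ⊕ q) ↓
    +↓ʳ : ∀ {p q} → p ↓ → (q ⊕ p) ↓
    ·↓  : ∀ {p q} → p ↓ → q ↓ → (p · q) ↓
    ⋆↓  : ∀ {p} → (p ⋆) ↓

  data _─⟨_⟩→_ : Exp A → A → Exp A → Set ℓ where
    act→ : ∀ {a} → act a ─⟨ a ⟩→ 𝟙
    +→ˡ  : ∀ {p q a p'} → p ─⟨ a ⟩→ p' → (p ⊕ q) ─⟨ a ⟩→ p'
    +→ʳ  : ∀ {p q a p'} → p ─⟨ a ⟩→ p' → (q ⊕ p) ─⟨ a ⟩→ p'
    ·→ˡ  : ∀ {p q a p'} → p ─⟨ a ⟩→ p' → (p · q) ─⟨ a ⟩→ (p' · q)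
    ·→ʳ  : ∀ {p q a q'} → p ↓ → q ─⟨ a ⟩→ q' → (p · q) ─⟨ a ⟩→ q'
    ⋆→   : ∀ {p a p'} → p ─⟨ a ⟩→ p' → (p ⋆) ─⟨ a ⟩→ (p' · (p ⋆))

  _⟶_ : Exp A → Exp A → Set ℓ
  p ⟶ q = Σ A (λ a → p ─⟨ a ⟩→ q)

  _⟶*_ : Exp A → Exp A → Set ℓ
  _⟶*_ = Star _⟶_

  ExpSet : Set (Level.suc ℓ)
  ExpSet = Exp A → Set ℓ

  IsSCC : ExpSet → Set ℓ
  IsSCC C =
    Σ (Exp A) C
    × (∀ s s' → C s → C s' → s ⟶* s')
    × (∀ s t → C s → s ⟶* t → t ⟶* s → C t)

  Trivial : ExpSet → Set ℓ
  Trivial C = Σ (Exp A) (λ s → C s × (∀ t → C t → t ≡ s) × ¬ (s ⟶ s))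

  NonTrivial : ExpSet → Set ℓ
  NonTrivial C = ¬ Trivial C

  Normed : Exp A → Set ℓ
  Normed s = Σ (Exp A) (λ s' → s ⟶* s' × s' ↓)

  InExtₙ : ExpSet → Exp A → A → Exp A → Set ℓ
  InExtₙ C s a s' = s ─⟨ a ⟩→ s' × ¬ C s' × Normed s'

  AliveExit : ExpSet → Exp A → Set ℓ
  AliveExit C s = C s × (s ↓ ⊎ Σ A (λ a → Σ (Exp A) (λ s' → InExtₙ C s a s')))

-- A state on a cycle must be a product u · v, and the cycle either stays inside u
-- or passes through v. In the first case the component of u · v is { u' · v | u'
-- in the component of u }, and the claim follows by induction on u: exits taken in
-- u are shared by induction, and exits through v are shared because alive states
-- of u terminate together. In the second case v must be a star z ⋆ (derivatives
-- of sums and products never contain the term itself); then every state reachable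
-- from u · z ⋆ has the form r · z ⋆ and every normed successor of it returns to
-- u · z ⋆ through z ⋆, so the component has no normed exits at all.
module Submission where

open import Defs
open import Level using (Level)
open import Function.Bundles using (_⇔_; mk⇔)
open import Data.Product using (∃; ∃₂; _×_; _,_; proj₁)
open import Data.Sum using (_⊎_; inj₁; inj₂)
open import Data.Empty using (⊥-elim)
open import Relation.Nullary using (¬_)
open import Relation.Binary.PropositionalEquality using (_≡_; refl)
open import Relation.Binary.Construct.Closure.ReflexiveTransitive
  using (Star; ε; _◅_; _◅◅_; gmap)
open import Data.Nat using (ℕ; suc; _+_; _≤_; _<_; s≤s)
open import Data.Nat.Properties using (≤-refl; ≤-trans; m≤m+n; m≤n+m; <⇒≤; <⇒≱)

module _ {ℓ : Level} {A : Set ℓ} where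

  _⟶⁺_ : Exp A → Exp A → Set ℓ
  x ⟶⁺ y = ∃ λ t → x ⟶ t × t ⟶* y

  ⟶⁺-◅◅ : ∀ {x y z} → x ⟶⁺ y → y ⟶* z → x ⟶⁺ z
  ⟶⁺-◅◅ (t , s , r) q = t , s , r ◅◅ q

  ⟶*-·ˡ : ∀ {u u' v : Exp A} → u ⟶* u' → (u · v) ⟶* (u' · v)
  ⟶*-·ˡ {v = v} = gmap (_· v) λ (a , tr) → a , ·→ˡ tr

  size : Exp A → ℕ
  size 𝟘       = 1
  size 𝟙       = 1
  size (act _) = 1
  size (p · q) = suc (size p + size q)
  size (p ⊕ q) = suc (size p + size q)
  size (p ⋆)   = suc (size p)

  data _⊏_ : Exp A → Exp A → Set ℓ where
    ·ˡ : ∀ {p q} → p ⊏ (p · q)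
    ·ʳ : ∀ {p q} → q ⊏ (p · q)
    ⊕ˡ : ∀ {p q} → p ⊏ (p ⊕ q)
    ⊕ʳ : ∀ {p q} → q ⊏ (p ⊕ q)
    ⋆ˢ : ∀ {p} → p ⊏ (p ⋆)

  _⊑_ : Exp A → Exp A → Set ℓ
  _⊑_ = Star _⊏_

  ⊏-size : ∀ {x y} → x ⊏ y → size x < size y
  ⊏-size {y = p · q} ·ˡ = s≤s (m≤m+n (size p) (size q))
  ⊏-size {y = p · q} ·ʳ = s≤s (m≤n+m (size q) (size p))
  ⊏-size {y = p ⊕ q} ⊕ˡ = s≤s (m≤m+n (size p) (size q))
  ⊏-size {y = p ⊕ q} ⊕ʳ = s≤s (m≤n+m (size q) (size p))
  ⊏-size ⋆ˢ             = ≤-refl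

  ⊑-size : ∀ {x y} → x ⊑ y → size x ≤ size y
  ⊑-size ε       = ≤-refl
  ⊑-size (c ◅ s) = ≤-trans (<⇒≤ (⊏-size c)) (⊑-size s)

  ⊏⇒⋣ : ∀ {x y} → x ⊏ y → ¬ (y ⊑ x)
  ⊏⇒⋣ c s = <⇒≱ (⊏-size c) (⊑-size s)

  -- Der t contains every state reachable from t (cf. Antimirov's partial derivatives).
  data Der (t : Exp A) : Exp A → Set ℓ where
    sub : ∀ {x} → x ⊑ t → Der t x
    𝟙   : Der t 𝟙
    _·_ : ∀ {y c} → Der t y → c ⊑ t → Der t (y · c)

  Der-mono : ∀ {t t' x} → t ⊑ t' → Der t x → Der t' x
  Der-mono s (sub s') = sub (s' ◅◅ s)
  Der-mono s 𝟙        = 𝟙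
  Der-mono s (d · s') = Der-mono s d · (s' ◅◅ s)

  Der-step : ∀ {x a x'} → x ─⟨ a ⟩→ x' → Der x x'
  Der-step act→       = 𝟙
  Der-step (+→ˡ tr)   = Der-mono (⊕ˡ ◅ ε) (Der-step tr)
  Der-step (+→ʳ tr)   = Der-mono (⊕ʳ ◅ ε) (Der-step tr)
  Der-step (·→ˡ tr)   = Der-mono (·ˡ ◅ ε) (Der-step tr) · (·ʳ ◅ ε)
  Der-step (·→ʳ _ tr) = Der-mono (·ʳ ◅ ε) (Der-step tr)
  Der-step (⋆→ tr)    = Der-mono (⋆ˢ ◅ ε) (Der-step tr) · ε

  Der-closed : ∀ {t x y} → Der t x → x ⟶* y → Der t y
  Der-closed d ε = d
  Der-closed d ((_ , tr) ◅ r) = Der-closed (step d tr) r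
    where
    step : ∀ {t x a x'} → Der t x → x ─⟨ a ⟩→ x' → Der t x'
    step (sub s) tr         = Der-mono s (Der-step tr)
    step (d · s) (·→ˡ tr)   = step d tr · s
    step (d · s) (·→ʳ _ tr) = Der-mono s (Der-step tr)

  ⟶⁺⇒Der : ∀ {x y} → x ⟶⁺ y → Der x y
  ⟶⁺⇒Der (_ , (_ , tr) , r) = Der-closed (Der-step tr) r

  ⟶⁺-⊕-inv : ∀ {p q t} → (p ⊕ q) ⟶⁺ t → Der p t ⊎ Der q t
  ⟶⁺-⊕-inv (_ , (_ , +→ˡ tr) , r) = inj₁ (Der-closed (Der-step tr) r)
  ⟶⁺-⊕-inv (_ , (_ , +→ʳ tr) , r) = inj₂ (Der-closed (Der-step tr) r)

  Der-⊕ : ∀ {t p q} → Der t (p ⊕ q) → (p ⊕ q) ⊑ t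
  Der-⊕ (sub s) = s

  Der-·ʳ : ∀ {t x v} → Der t (x · v) → v ⊑ t
  Der-·ʳ (sub s) = ·ʳ ◅ s
  Der-·ʳ (_ · s) = s

  ⟶⁺-·ʳ : ∀ {u v t} → u ↓ → v ⟶⁺ t → (u · v) ⟶* t
  ⟶⁺-·ʳ d (_ , (a , tr) , r) = (a , ·→ʳ d tr) ◅ r

  data ·-Reach (u v : Exp A) : Exp A → Set ℓ where
    left  : ∀ {u'} → u ⟶* u' → ·-Reach u v (u' · v)
    right : ∀ {u' t} → u ⟶* u' → u' ↓ → v ⟶⁺ t → ·-Reach u v t

  data ·-Reach⁺ (u v : Exp A) : Exp A → Set ℓ where
    left  : ∀ {u'} → u ⟶⁺ u' → ·-Reach⁺ u v (u' · v)
    right : ∀ {u' t} → u ⟶* u' → u' ↓ → v ⟶⁺ t → ·-Reach⁺ u v t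

  ⟶*-·-inv : ∀ {u v t} → (u · v) ⟶* t → ·-Reach u v t
  ⟶*-·-inv ε = left ε
  ⟶*-·-inv ((a , ·→ˡ tr) ◅ r) with ⟶*-·-inv r
  ... | left p      = left ((a , tr) ◅ p)
  ... | right p d q = right ((a , tr) ◅ p) d q
  ⟶*-·-inv ((a , ·→ʳ d tr) ◅ r) = right ε d (_ , (a , tr) , r)

  ⟶⁺-·-inv : ∀ {u v t} → (u · v) ⟶⁺ t → ·-Reach⁺ u v t
  ⟶⁺-·-inv (_ , (a , ·→ˡ tr) , r) with ⟶*-·-inv r
  ... | left p      = left (_ , (a , tr) , p)
  ... | right p d q = right ((a , tr) ◅ p) d q
  ⟶⁺-·-inv (_ , (a , ·→ʳ d tr) , r) = right ε d (_ , (a , tr) , r)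

  Normed-·ˡ : ∀ {u v} → Normed (u · v) → Normed u
  Normed-·ˡ (_ , r , d) with ⟶*-·-inv r | d
  ... | left p       | ·↓ d' _ = _ , p , d'
  ... | right p d' _ | _       = _ , p , d'

  data Ends⋆ (z : Exp A) : Exp A → Set ℓ where
    ends : ∀ r → Ends⋆ z (r · (z ⋆))

  Ends⋆-closed : ∀ {z x y} → Ends⋆ z x → x ⟶* y → Ends⋆ z y
  Ends⋆-closed e ε = e
  Ends⋆-closed e ((_ , tr) ◅ r) = Ends⋆-closed (step e tr) r
    where
    step : ∀ {z x a y} → Ends⋆ z x → x ─⟨ a ⟩→ y → Ends⋆ z y
    step (ends _) (·→ˡ _)        = ends _
    step (ends _) (·→ʳ _ (⋆→ _)) = ends _

  cycle⇒product : ∀ {x} → x ⟶⁺ x → ∃₂ λ u v → x ≡ u · v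
  cycle⇒product {𝟘} (_ , (_ , ()) , _)
  cycle⇒product {𝟙} (_ , (_ , ()) , _)
  cycle⇒product {act _} (_ , (_ , act→) , (_ , ()) ◅ _)
  cycle⇒product {u · v} _ = u , v , refl
  cycle⇒product {p ⊕ q} loop with ⟶⁺-⊕-inv loop
  ... | inj₁ d = ⊥-elim (⊏⇒⋣ ⊕ˡ (Der-⊕ d))
  ... | inj₂ d = ⊥-elim (⊏⇒⋣ ⊕ʳ (Der-⊕ d))
  cycle⇒product {z ⋆} (_ , (_ , ⋆→ _) , r) with Ends⋆-closed (ends _) r
  ... | ()

  tail-cycle⇒star : ∀ {u v} → v ⟶⁺ (u · v) → ∃ λ z → v ≡ z ⋆
  tail-cycle⇒star {v = 𝟘} (_ , (_ , ()) , _)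
  tail-cycle⇒star {v = 𝟙} (_ , (_ , ()) , _)
  tail-cycle⇒star {v = act _} (_ , (_ , act→) , (_ , ()) ◅ _)
  tail-cycle⇒star {v = p · q} loop with ⟶⁺-·-inv loop
  ... | right _ _ qx = ⊥-elim (⊏⇒⋣ ·ʳ (Der-·ʳ (⟶⁺⇒Der qx)))
  tail-cycle⇒star {v = p ⊕ q} loop with ⟶⁺-⊕-inv loop
  ... | inj₁ d = ⊥-elim (⊏⇒⋣ ⊕ˡ (Der-·ʳ d))
  ... | inj₂ d = ⊥-elim (⊏⇒⋣ ⊕ʳ (Der-·ʳ d))
  tail-cycle⇒star {v = z ⋆} _ = z , refl

  -- For y in the component of x, w lies outside that component iff ¬ (w ⟶* x).
  Exit : Exp A → Exp A → A → Exp A → Set ℓ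
  Exit x y a w = y ─⟨ a ⟩→ w × ¬ (w ⟶* x) × Normed w

  AliveIn : Exp A → Exp A → Set ℓ
  AliveIn x y = y ↓ ⊎ ∃₂ λ a w → Exit x y a w

  _≼_ : Exp A → Exp A → Set ℓ
  x ≼ y = (∀ {a w} → Exit x x a w → y ─⟨ a ⟩→ w) × (x ↓ → y ↓)

  NoNormedExit : Exp A → Set ℓ
  NoNormedExit x = ∀ {y a w} → x ⟶* y → y ─⟨ a ⟩→ w → Normed w → w ⟶* x

  NoNormedExit⇒≼ : ∀ {x y} → NoNormedExit x → x ⟶* y → AliveIn x y → x ≼ y
  NoNormedExit⇒≼ {x} {y} none xy ay =
    (λ (tr , back , nw) → ⊥-elim (back (none ε tr nw))) , λ _ → y↓ ay
    where
    y↓ : AliveIn x y → y ↓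
    y↓ (inj₁ d)                        = d
    y↓ (inj₂ (_ , _ , tr , back , nw)) = ⊥-elim (back (none xy tr nw))

  star-tail-NoNormedExit : ∀ {u z} → (z ⋆) ⟶⁺ (u · (z ⋆)) → NoNormedExit (u · (z ⋆))
  star-tail-NoNormedExit loop xy tr nw with Ends⋆-closed (ends _) xy
  ... | ends _ with Ends⋆-closed (ends _) ((_ , tr) ◅ ε)
  ...   | ends _ with Normed-·ˡ nw
  ...     | _ , r , d = ⟶*-·ˡ r ◅◅ ⟶⁺-·ʳ d loop

  tail-cycle-≼ : ∀ {u v y} → v ⟶⁺ (u · v) → (u · v) ⟶* y → AliveIn (u · v) y → (u · v) ≼ y
  tail-cycle-≼ vx xy ay with tail-cycle⇒star vx
  ... | _ , refl = NoNormedExit⇒≼ (star-tail-NoNormedExit vx) xy ay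

  AliveIn-·ˡ : ∀ {u v w} → AliveIn (u · v) (w · v) → AliveIn u w
  AliveIn-·ˡ (inj₁ (·↓ d _))                     = inj₁ d
  AliveIn-·ˡ (inj₂ (_ , _ , ·→ʳ d _ , _))        = inj₁ d
  AliveIn-·ˡ (inj₂ (_ , _ , ·→ˡ tr , back , nw)) =
    inj₂ (_ , _ , tr , (λ r → back (⟶*-·ˡ r)) , Normed-·ˡ nw)

  ≼-· : ∀ {u u₂ v} → u ≼ u₂ → (u · v) ≼ (u₂ · v)
  ≼-· {u} {u₂} {v} (exits , ↓⇒↓) = exits' , λ { (·↓ d e) → ·↓ (↓⇒↓ d) e }
    where
    exits' : ∀ {a w} → Exit (u · v) (u · v) a w → (u₂ · v) ─⟨ a ⟩→ w
    exits' (·→ˡ tr , back , nw) = ·→ˡ (exits (tr , (λ r → back (⟶*-·ˡ r)) , Normed-·ˡ nw))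
    exits' (·→ʳ d tr , _)       = ·→ʳ (↓⇒↓ d) tr

  cycle-≼ : ∀ x {y} → x ⟶⁺ x → x ⟶* y → y ⟶* x → AliveIn x x → AliveIn x y → x ≼ y
  cycle-≼ x loop xy yx ax ay with cycle⇒product loop
  ... | u , v , refl with ⟶⁺-·-inv loop | ⟶*-·-inv xy
  ...   | right _ _ vx | _            = tail-cycle-≼ vx xy ay
  ...   | left _       | right _ _ vy = tail-cycle-≼ (⟶⁺-◅◅ vy yx) xy ay
  ...   | left uu      | left uu₂ with ⟶*-·-inv yx
  ...     | right _ _ vx = tail-cycle-≼ vx xy ay
  ...     | left u₂u     = ≼-· (cycle-≼ u uu uu₂ u₂u (AliveIn-·ˡ ax) (AliveIn-·ˡ ay))

  component-≼ : ∀ {x y} → x ⟶* y → y ⟶* x → AliveIn x x → AliveIn x y → x ≼ y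
  component-≼ ε _ _ _ = (λ (tr , _) → tr) , λ d → d
  component-≼ {x} (s ◅ r) yx ax ay = cycle-≼ x (_ , s , r ◅◅ yx) (s ◅ r) yx ax ay

proposition20 : {ℓ : Level} {A : Set ℓ} → A → (C : ExpSet {A = A}) →
    IsSCC C → NonTrivial C → (p₁ p₂ : Exp A) →
    AliveExit C p₁ → AliveExit C p₂ →
    (a : A) (s' : Exp A) → InExtₙ C p₁ a s' ⇔ InExtₙ C p₂ a s'
proposition20 _ C (_ , connected , maximal) _ _ _ al₁ al₂ a s' =
  mk⇔ (shared al₁ al₂) (shared al₂ al₁)
  where
  leaves : ∀ {x y b w} → C y → y ─⟨ b ⟩→ w → x ⟶* y → ¬ C w → ¬ (w ⟶* x)
  leaves {y = y} {b} {w} cy tr xy ¬cw wx = ¬cw (maximal y w cy ((b , tr) ◅ ε) (wx ◅◅ xy))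

  aliveIn : ∀ {x y} → x ⟶* y → AliveExit C y → AliveIn x y
  aliveIn _  (_ , inj₁ d)                        = inj₁ d
  aliveIn xy (cy , inj₂ (_ , _ , tr , ¬cw , nw)) = inj₂ (_ , _ , tr , leaves cy tr xy ¬cw , nw)

  shared : ∀ {q₁ q₂} → AliveExit C q₁ → AliveExit C q₂ → InExtₙ C q₁ a s' → InExtₙ C q₂ a s'
  shared {q₁} {q₂} al@(cq₁ , _) al'@(cq₂ , _) (tr , ¬cs' , ns') =
    proj₁ (component-≼ there (connected q₂ q₁ cq₂ cq₁)
      (aliveIn ε al) (aliveIn there al')) (tr , leaves cq₁ tr ε ¬cs' , ns')
    , ¬cs' , ns'
    where
    there : q₁ ⟶* q₂
    there = connected q₁ q₂ cq₁ cq₂
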